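{- Let $n=p'q$ where $p',q$ are distinct primes, both at least $7$, and let $A=L(n;p')$. Then $D_A(n)=4$.
   Context: $\mathbb{Z}_n=\mathbb{Z}/n\mathbb{Z}$, $U(n)$ its unit group. For nonempty $A\subseteq\mathbb{Z}_n\setminus\{0\}$, a sequence $(x_1,\ldots,x_l)$ is an $A$-weighted zero-sum sequence if $a_1x_1+\cdots+a_lx_l=0$ for some $a_i\in A$; subsequences are nonempty; $D_A(n)$ is the least $k$ such that every sequence of length $k$ in $\mathbb{Z}_n$ has an $A$-weighted zero-sum subsequence. For odd $n=\prod p_i^{r_i}$ and $a\in U(n)$ the Jacobi symbol is $\left(\frac{a}{n}\right)=\prod_i\left(\frac{a\bmod p_i}{p_i}\right)^{r_i}$, and $\left(\frac{a}{p}\right)$ is the Legendre symbol of $a\bmod p$. $L(n;p')=\{a\in U(n): \left(\frac{a}{n}\right)=\left(\frac{a}{p'}\right)\}$. -}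

module Defs where

open import Data.Nat using (ℕ; zero; suc; _+_; _*_; _≤_; _%_)
open import Data.Nat.Properties using (_≟_)
open import Data.Nat.Divisibility using (_∣_)
open import Data.Nat.Coprimality using (Coprime)
open import Data.Fin using (Fin; toℕ)
open import Data.Fin.Properties using (any?)
open import Data.Fin.Subset using (Subset; _∈_)
open import Data.Integer using (ℤ; 0ℤ; 1ℤ; -1ℤ) renaming (_*_ to _*ℤ_)
open import Data.List using (List; []; _∷_)
open import Data.Product using (Σ; ∃; _×_)
open import Relation.Nullary using (yes; no)
open import Relation.Binary.PropositionalEquality using (_≡_)

Σ[<_]_ : (l : ℕ) → (Fin l → ℕ) → ℕ
Σ[< zero ] f = 0
Σ[< suc l ] f = f Fin.zero + Σ[< l ] (λ i → f (Fin.suc i))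


-- Legendre symbol (a / p): 0 if p ∣ a, 1 if a is a nonzero square mod p,
-- -1 otherwise.  (Only used for odd primes p; the p = 0 case is a dummy.)
legendre : ℕ → ℕ → ℤ
legendre a zero = 0ℤ
legendre a (suc k) with a % suc k ≟ 0
... | yes _ = 0ℤ
... | no _ with any? (λ (x : Fin (suc k)) → (toℕ x * toℕ x) % suc k ≟ a % suc k)
...   | yes _ = 1ℤ
...   | no _ = -1ℤ

-- Jacobi symbol (a / n) where n = product of the primes in the list ps
-- (prime factorisation listed with multiplicity): product of Legendre symbols.
jacobi : ℕ → List ℕ → ℤ
jacobi a [] = 1ℤ
jacobi a (p ∷ ps) = legendre a p *ℤ jacobi a ps

IsUnit : (n : ℕ) → Fin n → Set
IsUnit n a = Coprime (toℕ a) n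

L2 : (p' q : ℕ) → Fin (p' * q) → Set
L2 p' q a = IsUnit (p' * q) a × (jacobi (toℕ a) (p' ∷ q ∷ []) ≡ legendre (toℕ a) p')

HasWeightedZeroSumSubseq : (n : ℕ) (A : Fin n → Set) (l : ℕ) → (Fin l → Fin n) → Set
HasWeightedZeroSumSubseq n A l x =
  Σ (Subset l) λ I → (∃ λ i → i ∈ I) ×
  Σ (Fin l → Fin n) λ w → (∀ i → i ∈ I → A (w i)) ×
    (n ∣ Σ[< l ] (λ i → sel I i (toℕ (w i) * toℕ (x i))))
  where
  open import Data.Vec using (lookup)
  open import Data.Bool using (if_then_else_)
  sel : ∀ {l} → Subset l → Fin l → ℕ → ℕ
  sel I i v = if lookup I i then v else 0

DavenportProp : (n : ℕ) (A : Fin n → Set) (k : ℕ) → Set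
DavenportProp n A k = (x : Fin k → Fin n) → HasWeightedZeroSumSubseq n A k x

DavenportIs : (n : ℕ) (A : Fin n → Set) (d : ℕ) → Set
DavenportIs n A d = DavenportProp n A d × (∀ k → DavenportProp n A k → d ≤ k)

-- L(pq; p) consists of the units w with (w/q) = 1, so by the Chinese remainder theorem the
-- weights are the w with w ≡ u (mod p) and w ≡ s² (mod q) for some u, s prime to p, q.  A weighted
-- zero sum over a subsequence I thus splits into two independent problems: Σ u_i x_i ≡ 0 (mod p),
-- solvable with units unless exactly one x_i (i ∈ I) is nonzero mod p, and Σ s_i² x_i ≡ 0 (mod q),
-- solvable with s_i prime to q when no x_i or exactly three are nonzero mod q, because a ternary
-- form with unit coefficients modulo a prime q ≥ 7 has a zero with unit coordinates.  A finite check
-- shows that every sequence of length 4 has a subsequence of both kinds.  Conversely, for a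
-- non-residue r mod q the sequence (1, -r, q) has no such subsequence: modulo q a zero sum would
-- make r a ratio of squares, and the term q alone cannot vanish modulo p.

module Submission where

open import Defs

open import Data.Bool.Base using (Bool; true; false; if_then_else_; not)
open import Data.Bool.Properties using () renaming (_≟_ to _≟ᵇ_)
open import Data.Empty using (⊥)
open import Data.Fin.Base as Fin using (Fin; toℕ; fromℕ<; splitAt; join; punchIn; punchOut)
import Data.Fin.Properties as Fin
open import Data.Fin.Subset as Subset using (Subset; _∈_; _∉_; _∩_; ∁; ⁅_⁆; Nonempty; inside; outside)
open import Data.Fin.Subset.Properties
  using (nonempty?; anySubset?; ∣p∣≤n; _∈?_; x∈p∩q⁺; x∈p∩q⁻; ∉⊥; x∈⁅x⁆; x≢y⇒x∉⁅y⁆; x∉p⇒x∈∁p; x∈∁p⇒x∉p)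
open import Data.Integer.Base as ℤ using (ℤ; +_; _+_; _*_; _-_; -_; 0ℤ; 1ℤ; -1ℤ; _%ℕ_; _/ℕ_)
open import Data.Integer.DivMod using (n%ℕd<d; a≡a%ℕn+[a/ℕn]*n)
open import Data.Integer.Divisibility.Signed
import Data.Integer.Properties as ℤ
open import Data.Integer.Tactic.RingSolver using (solve-∀)
open import Algebra.Properties.CommutativeMonoid.Sum ℤ.+-0-commutativeMonoid using (sum; sum-remove; sum-cong-≗)
open import Data.Nat.Base as ℕ using (ℕ; zero; suc; NonZero; z≤n; s≤s)
open import Data.Nat.Coprimality as Coprime using (Coprime; coprime-Bézout; coprime-divisor; prime⇒coprime)
import Data.Nat.Divisibility as ℕ
open import Data.Nat.DivMod as ℕ using ()
open import Data.Nat.GCD using (module Bézout)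
open import Data.Nat.Primality
  using (Prime; euclidsLemma; prime⇒irreducible; prime⇒nonZero; prime⇒nonTrivial; ¬prime[1])
import Data.Nat.Properties as ℕ
open import Data.Product using (∃; ∃₂; _×_; _,_; proj₁; proj₂)
open import Data.Sum using (_⊎_; inj₁; inj₂; [_,_]′)
open import Data.Vec.Base using (_∷_; []; lookup; tabulate; here; there)
open import Data.Vec.Functional using (Vector; insertAt)
open import Data.Vec.Functional.Properties using (insertAt-lookup; insertAt-punchIn)
open import Data.Vec.Properties using (lookup⇒[]=; []=⇒lookup; lookup∘tabulate; ≡-dec)
open import Function.Base using (_∘_; case_of_)
open import Function.Definitions using (Injective)
open import Relation.Binary.PropositionalEquality
open import Relation.Nullary using (¬_; Dec; contradiction; yes; no; does)
open import Relation.Nullary.Decidable using (¬?; _×-dec_; _⊎-dec_; from-yes; decidable-stable)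
open import Relation.Unary using (Decidable)

private
  variable
    a b : ℤ
    d l : ℕ

∣-respʳ : a ≡ b → + d ∣ a → + d ∣ b
∣-respʳ {d = d} = subst (+ d ∣_)

∣a-a%ℕd : ∀ a d .{{_ : NonZero d}} → + d ∣ a - + (a %ℕ d)
∣a-a%ℕd a d = divides (a /ℕ d) (begin
  a - + (a %ℕ d)                             ≡⟨ cong (_- + (a %ℕ d)) (a≡a%ℕn+[a/ℕn]*n a d) ⟩
  + (a %ℕ d) + (a /ℕ d) * + d - + (a %ℕ d)   ≡⟨ cancel (+ (a %ℕ d)) ((a /ℕ d) * + d) ⟩
  (a /ℕ d) * + d                             ∎)
  where
  open ≡-Reasoning
  cancel : ∀ r t → r + t - r ≡ t
  cancel = solve-∀

m<d∧d∣m⇒m≡0 : ∀ {m} → m ℕ.< d → + d ∣ + m → m ≡ 0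
m<d∧d∣m⇒m≡0 {m = zero}  _   _   = refl
m<d∧d∣m⇒m≡0 {m = suc m} m<d d∣m = contradiction (ℕ.∣⇒≤ (∣⇒∣ᵤ d∣m)) (ℕ.<⇒≱ m<d)

private
  ordered-congruent⇒≡ : ∀ {m n} → m ℕ.≤ n → n ℕ.< d → + d ∣ + n - + m → m ≡ n
  ordered-congruent⇒≡ {m = m} {n} m≤n n<d d∣n-m = ℕ.≤-antisym m≤n (ℕ.m∸n≡0⇒m≤n
    (m<d∧d∣m⇒m≡0 (ℕ.≤-<-trans (ℕ.m∸n≤m n m) n<d) (∣-respʳ (trans (ℤ.m-n≡m⊖n n m) (ℤ.⊖-≥ m≤n)) d∣n-m)))

m,n<d∧d∣m-n⇒m≡n : ∀ {m n} → m ℕ.< d → n ℕ.< d → + d ∣ + m - + n → m ≡ n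
m,n<d∧d∣m-n⇒m≡n {m = m} {n} m<d n<d d∣m-n with ℕ.≤-total m n
... | inj₁ m≤n = ordered-congruent⇒≡ m≤n n<d (∣-respʳ (flip (+ m) (+ n)) (∣m⇒∣-m d∣m-n))
  where
  flip : ∀ u v → - (u - v) ≡ v - u
  flip = solve-∀
... | inj₂ n≤m = sym (ordered-congruent⇒≡ n≤m m<d d∣m-n)

residue : ℤ → (d : ℕ) .{{_ : NonZero d}} → Fin d
residue a d = fromℕ< (n%ℕd<d a d)

module _ {d : ℕ} .{{_ : NonZero d}} where

  ∣-residue : ∀ a → + d ∣ a - + toℕ (residue a d)
  ∣-residue a = subst (λ r → + d ∣ a - + r) (sym (Fin.toℕ-fromℕ< (n%ℕd<d a d))) (∣a-a%ℕd a d)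

  residue-≡⇒∣ : ∀ a b → residue a d ≡ residue b d → + d ∣ a - b
  residue-≡⇒∣ a b eq = ∣-respʳ (cancel a b (+ toℕ (residue b d)))
    (∣m∣n⇒∣m-n (subst (λ r → + d ∣ a - + toℕ r) eq (∣-residue a)) (∣-residue b))
    where
    cancel : ∀ a b r → (a - r) - (b - r) ≡ a - b
    cancel = solve-∀

  ∣⇒residue-≡ : ∀ a b → + d ∣ a - b → residue a d ≡ residue b d
  ∣⇒residue-≡ a b d∣a-b = Fin.toℕ-injective (m,n<d∧d∣m-n⇒m≡n (Fin.toℕ<n _) (Fin.toℕ<n _)
    (∣-respʳ (cancel a b (+ toℕ (residue a d)) (+ toℕ (residue b d)))
      (∣m∣n⇒∣m+n (∣m∣n⇒∣m-n d∣a-b (∣-residue a)) (∣-residue b))))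
    where
    cancel : ∀ a b r s → (a - b) - (a - r) + (b - s) ≡ r - s
    cancel = solve-∀

  m%d≡n%d⇒d∣m-n : ∀ m n → m ℕ.% d ≡ n ℕ.% d → + d ∣ + m - + n
  m%d≡n%d⇒d∣m-n m n eq = residue-≡⇒∣ (+ m) (+ n)
    (Fin.toℕ-injective (trans (Fin.toℕ-fromℕ< _) (trans eq (sym (Fin.toℕ-fromℕ< _)))))

  d∣m-n⇒m%d≡n%d : ∀ m n → + d ∣ + m - + n → m ℕ.% d ≡ n ℕ.% d
  d∣m-n⇒m%d≡n%d m n d∣m-n =
    trans (sym (Fin.toℕ-fromℕ< _)) (trans (cong toℕ (∣⇒residue-≡ (+ m) (+ n) d∣m-n)) (Fin.toℕ-fromℕ< _))

  d∤m⇒m%d≢0 : ∀ {m} → ¬ + d ∣ + m → m ℕ.% d ≢ 0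
  d∤m⇒m%d≢0 {m} d∤m m%d≡0 = d∤m (∣ᵤ⇒∣ (ℕ.m%n≡0⇒n∣m m d m%d≡0))

  residue-toℕ : ∀ v → residue (+ toℕ v) d ≡ v
  residue-toℕ v = Fin.toℕ-injective (trans (Fin.toℕ-fromℕ< _) (ℕ.m<n⇒m%n≡m (Fin.toℕ<n v)))

-- Bézout's identity and arithmetic modulo a prime

private
  lift-1+*≡* : ∀ {i j k l} → 1 ℕ.+ i ℕ.* j ≡ k ℕ.* l → 1ℤ + + i * + j ≡ + k * + l
  lift-1+*≡* {i} {j} {k} {l} eq = begin
    1ℤ + + i * + j     ≡⟨ cong (λ t → 1ℤ + t) (ℤ.pos-* i j) ⟨
    + (1 ℕ.+ i ℕ.* j)  ≡⟨ cong +_ eq ⟩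
    + (k ℕ.* l)        ≡⟨ ℤ.pos-* k l ⟩
    + k * + l          ∎
    where open ≡-Reasoning

bézout : ∀ {m n} → Coprime m n → ∃₂ λ u v → u * + m + v * + n ≡ 1ℤ
bézout {m} {n} c with coprime-Bézout c
... | Bézout.+- u v eq = + u , - + v , (begin
  + u * + m + - + v * + n         ≡⟨ cong (λ t → t + - + v * + n) (lift-1+*≡* {v} {n} {u} {m} eq) ⟨
  1ℤ + + v * + n + - + v * + n    ≡⟨ cancel (+ v) (+ n) ⟩
  1ℤ                              ∎)
  where
  open ≡-Reasoning
  cancel : ∀ v x → 1ℤ + v * x + - v * x ≡ 1ℤ
  cancel = solve-∀
... | Bézout.-+ u v eq = - + u , + v , (begin
  - + u * + m + + v * + n         ≡⟨ cong (λ t → - + u * + m + t) (lift-1+*≡* {u} {m} {v} {n} eq) ⟨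
  - + u * + m + (1ℤ + + u * + m)  ≡⟨ cancel (+ u) (+ m) ⟩
  1ℤ                              ∎)
  where
  open ≡-Reasoning
  cancel : ∀ u m → - u * m + (1ℤ + u * m) ≡ 1ℤ
  cancel = solve-∀

chinese-remainder : ∀ {m n} → Coprime m n → ∀ a b → ∃ λ w → + m ∣ w - a × + n ∣ w - b
chinese-remainder {m} {n} c a b with bézout c
... | u , v , E = w ,
  divides ((b - a) * u) (begin
    w - a                              ≡⟨ cong (λ t → w - t) (ℤ.*-identityʳ a) ⟨
    w - a * 1ℤ                         ≡⟨ cong (λ one → w - a * one) E ⟨
    w - a * (u * + m + v * + n)        ≡⟨ split-m a b u v (+ m) (+ n) ⟩
    (b - a) * u * + m                  ∎) ,
  divides ((a - b) * v) (begin
    w - b                              ≡⟨ cong (λ t → w - t) (ℤ.*-identityʳ b) ⟨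
    w - b * 1ℤ                         ≡⟨ cong (λ one → w - b * one) E ⟨
    w - b * (u * + m + v * + n)        ≡⟨ split-x a b u v (+ m) (+ n) ⟩
    (a - b) * v * + n                  ∎)
  where
  open ≡-Reasoning
  w = a * (v * + n) + b * (u * + m)
  split-m : ∀ a b u v m x → a * (v * x) + b * (u * m) - a * (u * m + v * x) ≡ (b - a) * u * m
  split-m = solve-∀
  split-x : ∀ a b u v m x → a * (v * x) + b * (u * m) - b * (u * m + v * x) ≡ (a - b) * v * x
  split-x = solve-∀

prime∤⇒coprime : ∀ {p m} → Prime p → ¬ + p ∣ + m → Coprime m p
prime∤⇒coprime p-prime p∤m (d∣m , d∣p) with prime⇒irreducible p-prime d∣p
... | inj₁ d≡1 = d≡1
... | inj₂ refl = contradiction (∣ᵤ⇒∣ d∣m) p∤m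

coprime-*ʳ : ∀ {m a b} → Coprime m a → Coprime m b → Coprime m (a ℕ.* b)
coprime-*ʳ {m} m⊥a m⊥b (d∣m , d∣ab) =
  m⊥b (d∣m , coprime-divisor (λ (e∣d , e∣a) → m⊥a (ℕ.∣-trans e∣d d∣m , e∣a)) d∣ab)

coprime⇒*∣ : ∀ {a b c} → Coprime a b → + a ∣ c → + b ∣ c → + (a ℕ.* b) ∣ c
coprime⇒*∣ {a} {b} {c} a⊥b a∣c b∣c with ∣⇒∣ᵤ a∣c | ∣⇒∣ᵤ b∣c
... | ℕ.divides k c≡ka | b∣c′
  with coprime-divisor (Coprime.sym a⊥b) (subst (b ℕ.∣_) (trans c≡ka (ℕ.*-comm k a)) b∣c′)
...   | ℕ.divides j k≡jb = ∣ᵤ⇒∣ (ℕ.divides j (trans c≡ka (trans (cong (ℕ._* a) k≡jb)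
          (trans (ℕ.*-assoc j b a) (cong (j ℕ.*_) (ℕ.*-comm b a))))))

module _ {p : ℕ} (p-prime : Prime p) where

  prime∣*⇒∣⊎∣ : + p ∣ a * b → + p ∣ a ⊎ + p ∣ b
  prime∣*⇒∣⊎∣ {a} {b} p∣ab with euclidsLemma ℤ.∣ a ∣ ℤ.∣ b ∣ p-prime (subst (p ℕ.∣_) (ℤ.abs-* a b) (∣⇒∣ᵤ p∣ab))
  ... | inj₁ p∣a = inj₁ (∣ᵤ⇒∣ p∣a)
  ... | inj₂ p∣b = inj₂ (∣ᵤ⇒∣ p∣b)

  prime∤* : ¬ + p ∣ a → ¬ + p ∣ b → ¬ + p ∣ a * b
  prime∤* p∤a p∤b p∣ab with prime∣*⇒∣⊎∣ p∣ab
  ... | inj₁ p∣a = p∤a p∣a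
  ... | inj₂ p∣b = p∤b p∣b

  prime∤small : ∀ {m} → 0 ℕ.< m → m ℕ.< p → ¬ + p ∣ + m
  prime∤small {suc m} _ m<p p∣m = ℕ.1+n≢0 (m<d∧d∣m⇒m≡0 m<p p∣m)

  prime>1 : 1 ℕ.< p
  prime>1 = ℕ.nonTrivial⇒n>1 p {{prime⇒nonTrivial p-prime}}

  prime∤1 : ¬ + p ∣ 1ℤ
  prime∤1 = prime∤small (s≤s z≤n) prime>1

  ∣ab-1⇒∤b : + p ∣ a * b - 1ℤ → ¬ + p ∣ b
  ∣ab-1⇒∤b {a} {b} p∣ab-1 p∣b = prime∤1 (∣-respʳ (cancel a b) (∣m∣n⇒∣m-n (∣n⇒∣m*n a p∣b) p∣ab-1))
    where
    cancel : ∀ a b → a * b - (a * b - 1ℤ) ≡ 1ℤ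
    cancel = solve-∀

  private instance
    p≢0 : NonZero p
    p≢0 = prime⇒nonZero p-prime

  mod-inverse : ¬ + p ∣ a → ∃ λ b → + p ∣ a * b - 1ℤ
  mod-inverse {a} p∤a with a %ℕ p in a%p≡r | ∣a-a%ℕd a p
  ... | zero  | p∣a-0 = contradiction (∣-respʳ (ℤ.+-identityʳ a) p∣a-0) p∤a
  ... | suc r | p∣a-r with bézout (prime⇒coprime p-prime (subst (ℕ._< p) a%p≡r (n%ℕd<d a p)))
  ...   | u , v , E = v , ∣-respʳ (rearrange a v u (+ p) (+ suc r) E)
                            (∣m∣n⇒∣m+n (∣n⇒∣m*n v p∣a-r) (divides (- u) refl))
    where
    rearrange : ∀ a v u p r → u * p + v * r ≡ 1ℤ → v * (a - r) + - u * p ≡ a * v - 1ℤ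
    rearrange a v u p r E = begin
      v * (a - r) + - u * p       ≡⟨ expand a v u p r ⟩
      a * v - (u * p + v * r)     ≡⟨ cong (λ one → a * v - one) E ⟩
      a * v - 1ℤ                  ∎
      where
      open ≡-Reasoning
      expand : ∀ a v u p r → v * (a - r) + - u * p ≡ a * v - (u * p + v * r)
      expand = solve-∀

  ratio-of-squares-is-square : ∀ {a b r s t} → ¬ + p ∣ t → + p ∣ a - s * s → + p ∣ b - t * t → + p ∣ a - b * r →
                     ∃ λ y → + p ∣ y * y - r
  ratio-of-squares-is-square {a} {b} {r} {s} {t} p∤t p∣a-s² p∣b-t² p∣a-br =
    let i , p∣ti-1 = mod-inverse p∤t
    in s * i , ∣-respʳ (identity a b r s t i)
         (∣m∣n⇒∣m+n (∣m∣n⇒∣m+n (∣m∣n⇒∣m+n (∣n⇒∣m*n (i * i) (∣m⇒∣-m p∣a-s²)) (∣n⇒∣m*n (i * i) p∣a-br))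
                                (∣n⇒∣m*n (i * i * r) p∣b-t²))
                    (∣n⇒∣m*n (r * (t * i + 1ℤ)) p∣ti-1))
    where
    identity : ∀ a b r s t i → i * i * - (a - s * s) + i * i * (a - b * r) + i * i * r * (b - t * t)
                                 + r * (t * i + 1ℤ) * (t * i - 1ℤ) ≡ s * i * (s * i) - r
    identity = solve-∀

select : Bool → ℤ → ℤ
select b v = if b then v else 0ℤ

restrict : Subset l → Vector ℤ l → Vector ℤ l
restrict I f i = select (lookup I i) (f i)

sum-restrict-pos : ∀ (I : Subset l) (g : Fin l → ℕ) →
  + (Σ[< l ] (λ i → if lookup I i then g i else 0)) ≡ sum (restrict I (λ i → + g i))
sum-restrict-pos [] g = refl
sum-restrict-pos {suc l} (b ∷ I) g =
  trans (ℤ.pos-+ (if b then g Fin.zero else 0) (Σ[< l ] (λ i → if lookup I i then g (Fin.suc i) else 0)))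
        (cong₂ _+_ (pos-if b) (sum-restrict-pos I (g ∘ Fin.suc)))
  where
  pos-if : ∀ b → + (if b then g Fin.zero else 0) ≡ select b (+ g Fin.zero)
  pos-if true  = refl
  pos-if false = refl

∣-sum : ∀ {f : Vector ℤ l} → (∀ i → + d ∣ f i) → + d ∣ sum f
∣-sum {zero}  _ = divides 0ℤ refl
∣-sum {suc l} d∣f = ∣m∣n⇒∣m+n (d∣f Fin.zero) (∣-sum (d∣f ∘ Fin.suc))

sum-cong-∣ : ∀ {f g : Vector ℤ l} → (∀ i → + d ∣ f i - g i) → + d ∣ sum f - sum g
sum-cong-∣ {zero}  _ = divides 0ℤ refl
sum-cong-∣ {suc l} {f = f} {g} d∣f-g =
  ∣-respʳ (interchange (f Fin.zero) (g Fin.zero) (sum (f ∘ Fin.suc)) (sum (g ∘ Fin.suc)))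
  (∣m∣n⇒∣m+n (d∣f-g Fin.zero) (sum-cong-∣ (d∣f-g ∘ Fin.suc)))
  where
  interchange : ∀ a b c e → a - b + (c - e) ≡ a + c - (b + e)
  interchange = solve-∀

restrict-supported : ∀ (I : Subset l) f → (∀ i → i ∉ I → f i ≡ 0ℤ) → ∀ i → restrict I f i ≡ f i
restrict-supported I f f≡0 i with lookup I i in I[i]
... | true  = refl
... | false = sym (f≡0 i (λ i∈I → case (trans (sym I[i]) ([]=⇒lookup i∈I)) of λ ()))

restrict-∈ : ∀ (I : Subset l) f {i} → i ∈ I → restrict I f i ≡ f i
restrict-∈ I f {i} i∈I = cong (λ b → select b (f i)) ([]=⇒lookup i∈I)

restrict-∣ : ∀ (I : Subset l) {f i} → (i ∈ I → + d ∣ f i) → + d ∣ restrict I f i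
restrict-∣ I {i = i} d∣f with lookup I i in I[i]
... | true  = d∣f (lookup⇒[]= i I I[i])
... | false = divides 0ℤ refl

restrict-cong-∣ : ∀ (I : Subset l) {f g : Vector ℤ l} → (∀ i → i ∈ I → + d ∣ f i - g i) →
                  ∀ i → + d ∣ restrict I f i - restrict I g i
restrict-cong-∣ I d∣f-g i with lookup I i in I[i]
... | true  = d∣f-g i (lookup⇒[]= i I I[i])
... | false = divides 0ℤ refl

restricted-sum-cong : ∀ (I : Subset l) f g → (∀ i → i ∈ I → + d ∣ f i - g i) →
                      + d ∣ sum (restrict I f) → + d ∣ sum (restrict I g)
restricted-sum-cong I f g d∣f-g d∣Σf = ∣-respʳ (cancel (sum (restrict I f)) (sum (restrict I g)))
  (∣m∣n⇒∣m-n d∣Σf (sum-cong-∣ (restrict-cong-∣ I d∣f-g)))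
  where
  cancel : ∀ a b → a - (a - b) ≡ b
  cancel = solve-∀

nonzeroMod : ℕ → Vector ℤ l → Subset l
nonzeroMod d X = tabulate (λ i → not (does (+ d ∣? X i)))

module _ {d : ℕ} (X : Vector ℤ l) {i : Fin l} where

  private
    bit≡ : lookup (nonzeroMod d X) i ≡ not (does (+ d ∣? X i))
    bit≡ = lookup∘tabulate _ i

  ∈-nonzeroMod⇒∤ : i ∈ nonzeroMod d X → ¬ + d ∣ X i
  ∈-nonzeroMod⇒∤ i∈ = refuted (+ d ∣? X i) (trans (sym bit≡) ([]=⇒lookup i∈))
    where
    refuted : ∀ {P : Set} (P? : Dec P) → not (does P?) ≡ true → ¬ P
    refuted (no ¬P) _ = ¬P

  ∉-nonzeroMod⇒∣ : i ∉ nonzeroMod d X → + d ∣ X i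
  ∉-nonzeroMod⇒∣ i∉ = confirmed (+ d ∣? X i) (λ bit → i∉ (lookup⇒[]= i _ (trans bit≡ bit)))
    where
    confirmed : ∀ {P : Set} (P? : Dec P) → not (does P?) ≢ true → P
    confirmed (yes P) _      = P
    confirmed (no _)  ¬true = contradiction refl ¬true

indicator : Subset l → Vector ℤ l
indicator J i = select (lookup J i) 1ℤ

sum-indicator : ∀ (J : Subset l) → sum (indicator J) ≡ + Subset.∣ J ∣
sum-indicator []            = refl
sum-indicator (outside ∷ J) = trans (ℤ.+-identityˡ _) (sum-indicator J)
sum-indicator (inside ∷ J)  = cong (λ t → 1ℤ + t) (sum-indicator J)

balance : Subset l → Vector ℤ l
balance (outside ∷ J) Fin.zero    = 0ℤ
balance (outside ∷ J) (Fin.suc i) = balance J i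
balance (inside ∷ J)  Fin.zero    = - + Subset.∣ J ∣
balance (inside ∷ J)  (Fin.suc i) = indicator J i

sum-balance : ∀ (J : Subset l) → sum (balance J) ≡ 0ℤ
sum-balance []            = refl
sum-balance (outside ∷ J) = trans (ℤ.+-identityˡ _) (sum-balance J)
sum-balance (inside ∷ J)  =
  trans (cong (λ t → - + Subset.∣ J ∣ + t) (sum-indicator J)) (ℤ.+-inverseˡ (+ Subset.∣ J ∣))

balance-∉ : ∀ (J : Subset l) {i} → i ∉ J → balance J i ≡ 0ℤ
balance-∉ (outside ∷ J) {Fin.zero}  _   = refl
balance-∉ (outside ∷ J) {Fin.suc i} i∉J = balance-∉ J (i∉J ∘ there)
balance-∉ (inside ∷ J)  {Fin.zero}  i∉J = contradiction here i∉J
balance-∉ (inside ∷ J)  {Fin.suc i} i∉J with lookup J i in J[i]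
... | true  = contradiction (there (lookup⇒[]= i J J[i])) i∉J
... | false = refl

balance-∈ : ∀ (J : Subset l) {i} → 1 ℕ.< d → Subset.∣ J ∣ ≢ 1 → Subset.∣ J ∣ ℕ.≤ d →
            i ∈ J → ¬ + d ∣ balance J i
balance-∈ (outside ∷ J) 1<d ∣J∣≢1 ∣J∣≤d (there i∈J) = balance-∈ J 1<d ∣J∣≢1 ∣J∣≤d i∈J
balance-∈ {d = d} (inside ∷ J) 1<d ∣J∣≢1 ∣J∣≤d here = d∤-∣J∣
  where
  d∤-∣J∣ : ¬ + d ∣ - + Subset.∣ J ∣
  d∤-∣J∣ d∣-∣J∣ = ∣J∣≢1 (cong suc (m<d∧d∣m⇒m≡0 ∣J∣≤d (∣-respʳ (ℤ.neg-involutive _) (∣m⇒∣-m d∣-∣J∣))))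
balance-∈ (inside ∷ J) {Fin.suc i} 1<d _ _ (there i∈J) d∣indicator =
  ℕ.1+n≢0 (m<d∧d∣m⇒m≡0 1<d (subst (λ b → + _ ∣ select b 1ℤ) ([]=⇒lookup i∈J) d∣indicator))

-- The units are chosen with u i * X i ≡ balance K i, so the sum is congruent to sum (balance K) = 0.
units-annihilate : ∀ {p} → Prime p → ∀ (X : Vector ℤ l) (I : Subset l) →
                   Subset.∣ I ∩ nonzeroMod p X ∣ ≢ 1 → Subset.∣ I ∩ nonzeroMod p X ∣ ℕ.≤ p →
                   ∃ λ u → (∀ i → ¬ + p ∣ u i) × + p ∣ sum (restrict I (λ i → u i * X i))
units-annihilate {p = p} p-prime X I ∣K∣≢1 ∣K∣≤p = u , p∤u , p∣Σ
  where
  K = I ∩ nonzeroMod p X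
  e = balance K
  inverse : ∀ {i} → i ∈ K → ∃ λ b → + p ∣ X i * b - 1ℤ
  inverse {i} i∈K = mod-inverse p-prime (∈-nonzeroMod⇒∤ X (proj₂ (x∈p∩q⁻ I _ i∈K)))
  unit : ∀ i → Dec (i ∈ K) → ℤ
  unit i (yes i∈K) = e i * proj₁ (inverse i∈K)
  unit i (no _)    = 1ℤ
  u : Vector ℤ _
  u i = unit i (i ∈? K)
  p∤u : ∀ i → ¬ + p ∣ u i
  p∤u i with i ∈? K
  ... | yes i∈K = prime∤* p-prime (balance-∈ K (prime>1 p-prime) ∣K∣≢1 ∣K∣≤p i∈K)
                                  (∣ab-1⇒∤b p-prime {a = X i} (proj₂ (inverse i∈K)))
  ... | no _    = prime∤1 p-prime
  e≡uX : ∀ i → i ∈ I → + p ∣ e i - u i * X i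
  e≡uX i i∈I with i ∈? K
  ... | yes i∈K = ∣-respʳ (factor (e i) (proj₁ (inverse i∈K)) (X i)) (∣m⇒∣-m (∣n⇒∣m*n (e i) (proj₂ (inverse i∈K))))
    where
    factor : ∀ e b x → - (e * (x * b - 1ℤ)) ≡ e - e * b * x
    factor = solve-∀
  ... | no i∉K = ∣-respʳ (trans (factor (X i)) (cong (λ e → e - 1ℤ * X i) (sym (balance-∉ K i∉K))))
                   (∣m⇒∣-m (∉-nonzeroMod⇒∣ X (λ i∈Y → i∉K (x∈p∩q⁺ (i∈I , i∈Y)))))
    where
    factor : ∀ x → - x ≡ 0ℤ - 1ℤ * x
    factor = solve-∀
  p∣Σ : + p ∣ sum (restrict I (λ i → u i * X i))
  p∣Σ = restricted-sum-cong I e (λ i → u i * X i) e≡uX (∣-respʳ (sym Σe≡0) (divides 0ℤ refl))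
    where
    Σe≡0 : sum (restrict I e) ≡ 0ℤ
    Σe≡0 = trans (sum-cong-≗ (restrict-supported I e (λ i i∉I → balance-∉ K (i∉I ∘ proj₁ ∘ x∈p∩q⁻ I _))))
                 (sum-balance K)

-- Quadratic forms modulo an odd prime

splitAt-injective : ∀ k {l} {i j : Fin (k ℕ.+ l)} → splitAt k i ≡ splitAt k j → i ≡ j
splitAt-injective k {l} {i} {j} eq =
  trans (sym (Fin.join-splitAt k l i)) (trans (cong (join k l) eq) (Fin.join-splitAt k l j))

injective-images-meet : ∀ {k l n} (f : Fin k → Fin n) (g : Fin l → Fin n) →
  Injective _≡_ _≡_ f → Injective _≡_ _≡_ g → n ℕ.< k ℕ.+ l → ∃₂ λ i j → f i ≡ g j
injective-images-meet {k} {l} f g f-inj g-inj n<k+l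
  with i , j , i<j , fgi≡fgj ← Fin.pigeonhole n<k+l ([ f , g ]′ ∘ splitAt k)
  with splitAt k i in i≡ | splitAt k j in j≡
... | inj₁ a | inj₁ b = contradiction
  (splitAt-injective k (trans i≡ (trans (cong inj₁ (f-inj fgi≡fgj)) (sym j≡)))) (Fin.<⇒≢ i<j)
... | inj₂ a | inj₂ b = contradiction
  (splitAt-injective k (trans i≡ (trans (cong inj₂ (g-inj fgi≡fgj)) (sym j≡)))) (Fin.<⇒≢ i<j)
... | inj₁ a | inj₂ b = a , b , fgi≡fgj
... | inj₂ a | inj₁ b = b , a , sym fgi≡fgj

module Squares {q : ℕ} (q-prime : Prime q) (q≢2 : q ≢ 2) where

  private instance
    q≢0 : NonZero q
    q≢0 = prime⇒nonZero q-prime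

  half : ℕ
  half = q ℕ./ 2

  q≡1+2half : q ≡ suc (half ℕ.+ half)
  q≡1+2half = trans (ℕ.m≡m%n+[m/n]*n q 2)
    (cong₂ ℕ._+_ q%2≡1 (trans (ℕ.*-comm half 2) (cong (half ℕ.+_) (ℕ.+-identityʳ half))))
    where
    q%2≡1 : q ℕ.% 2 ≡ 1
    q%2≡1 with q ℕ.% 2 in q%2≡ | ℕ.m%n<n q 2
    ... | 0 | _ with prime⇒irreducible q-prime (ℕ.m%n≡0⇒n∣m q 2 q%2≡)
    ...   | inj₂ 2≡q = contradiction (sym 2≡q) q≢2
    q%2≡1 | 1 | _ = refl
    q%2≡1 | suc (suc _) | s≤s (s≤s ())

  half<q : half ℕ.< q
  half<q = subst (half ℕ.<_) (sym q≡1+2half) (s≤s (ℕ.m≤m+n half half))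

  squares-≤half-injective : ∀ {c x y} → ¬ + q ∣ c → x ℕ.≤ half → y ℕ.≤ half →
                            + q ∣ c * (+ x * + x - + y * + y) → x ≡ y
  squares-≤half-injective {c} {x} {y} q∤c x≤h y≤h q∣c[x²-y²]
    with prime∣*⇒∣⊎∣ q-prime q∣c[x²-y²]
  ... | inj₁ q∣c = contradiction q∣c q∤c
  ... | inj₂ q∣x²-y² with prime∣*⇒∣⊎∣ q-prime (∣-respʳ (factor (+ x) (+ y)) q∣x²-y²)
    where
    factor : ∀ x y → x * x - y * y ≡ (x - y) * (x + y)
    factor = solve-∀
  ...   | inj₁ q∣x-y = m,n<d∧d∣m-n⇒m≡n (ℕ.≤-<-trans x≤h half<q) (ℕ.≤-<-trans y≤h half<q) q∣x-y
  ...   | inj₂ q∣x+y = trans (ℕ.m+n≡0⇒m≡0 x x+y≡0) (sym (ℕ.m+n≡0⇒n≡0 x x+y≡0))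
    where
    x+y≡0 : x ℕ.+ y ≡ 0
    x+y≡0 = m<d∧d∣m⇒m≡0 (subst (x ℕ.+ y ℕ.<_) (sym q≡1+2half) (s≤s (ℕ.+-mono-≤ x≤h y≤h)))
                         (∣-respʳ (sym (ℤ.pos-+ x y)) q∣x+y)

  square : Fin (suc half) → ℤ
  square y = + toℕ y * + toℕ y

  scaled-squares-injective : ∀ {c} → ¬ + q ∣ c → ∀ a → Injective _≡_ _≡_ (λ y → residue (a + c * square y) q)
  scaled-squares-injective {c} q∤c a {y} {z} eq = Fin.toℕ-injective
    (squares-≤half-injective q∤c (Fin.toℕ≤pred[n] y) (Fin.toℕ≤pred[n] z)
      (∣-respʳ (factor a c (+ toℕ y) (+ toℕ z)) (residue-≡⇒∣ (a + c * square y) (a + c * square z) eq)))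
    where
    factor : ∀ a c y z → a + c * (y * y) - (a + c * (z * z)) ≡ c * (y * y - z * z)
    factor = solve-∀

  binary-form-surjective : ∀ {a b} → ¬ + q ∣ a → ¬ + q ∣ b → ∀ c →
                           ∃₂ λ s t → + q ∣ a * (s * s) + b * (t * t) - c
  binary-form-surjective {a} {b} q∤a q∤b c =
    let y , z , eq = injective-images-meet _ _ (scaled-squares-injective q∤a 0ℤ)
                       (scaled-squares-injective q∤-b c) q<2[1+half]
    in + toℕ y , + toℕ z , ∣-respʳ (rearrange a b c (square y) (square z))
                             (residue-≡⇒∣ (0ℤ + a * square y) (c + - b * square z) eq)
    where
    q∤-b : ¬ + q ∣ - b
    q∤-b q∣-b = q∤b (∣-respʳ (ℤ.neg-involutive b) (∣m⇒∣-m q∣-b))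
    q<2[1+half] : q ℕ.< suc half ℕ.+ suc half
    q<2[1+half] = subst₂ ℕ._<_ (sym q≡1+2half) (cong suc (sym (ℕ.+-suc half half))) ℕ.≤-refl
    rearrange : ∀ a b c s t → 0ℤ + a * s - (c + - b * t) ≡ a * s + b * t - c
    rearrange = solve-∀

  square-fromℕ< : ∀ {t} (t≤h : t ℕ.≤ half) → square (fromℕ< (s≤s t≤h)) ≡ + t * + t
  square-fromℕ< t≤h = cong (λ u → + u * + u) (Fin.toℕ-fromℕ< (s≤s t≤h))

  square-representative : ∀ y → ∃ λ z → + q ∣ y * y - square z
  square-representative y with toℕ (residue y q) ℕ.≤? half | ∣-residue {q} y | Fin.toℕ<n (residue y q)
  ... | yes t≤h | q∣y-t | _ = fromℕ< (s≤s t≤h) ,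
    ∣-respʳ (trans (factor y (+ toℕ (residue y q))) (cong (λ u → y * y - u) (sym (square-fromℕ< t≤h))))
      (∣m⇒∣m*n (y + + toℕ (residue y q)) q∣y-t)
    where
    factor : ∀ y t → (y - t) * (y + t) ≡ y * y - t * t
    factor = solve-∀
  ... | no t≰h | q∣y-t | t<q = fromℕ< (s≤s q-t≤h) ,
    ∣-respʳ (trans (factor y t (+ q)) (cong (λ u → y * y - u) (trans q-t²≡ (sym (square-fromℕ< q-t≤h)))))
      (∣n⇒∣m*n (y + t - + q) (∣m∣n⇒∣m+n q∣y-t ∣-refl))
    where
    t = + toℕ (residue y q)
    q-t≤h : q ℕ.∸ toℕ (residue y q) ℕ.≤ half
    q-t≤h = ℕ.≤-trans (ℕ.∸-monoʳ-≤ q (ℕ.≰⇒> t≰h))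
              (ℕ.≤-reflexive (trans (cong (ℕ._∸ suc half) q≡1+2half) (ℕ.m+n∸m≡n half half)))
    q-t≡ : + q - t ≡ + (q ℕ.∸ toℕ (residue y q))
    q-t≡ = trans (ℤ.m-n≡m⊖n q (toℕ (residue y q))) (ℤ.⊖-≥ (ℕ.<⇒≤ t<q))
    q-t²≡ : (+ q - t) * (+ q - t) ≡ + (q ℕ.∸ toℕ (residue y q)) * + (q ℕ.∸ toℕ (residue y q))
    q-t²≡ = cong (λ u → u * u) q-t≡
    factor : ∀ y t q → (y + t - q) * (y - t + q) ≡ y * y - (q - t) * (q - t)
    factor = solve-∀

  quadratic-nonresidue : ∃ λ r → ¬ + q ∣ r × ∀ y → ¬ + q ∣ y * y - r
  quadratic-nonresidue with Fin.all? (λ v → Fin.any? (λ z → residue (square z) q Fin.≟ v))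
  ... | yes every-square = contradiction (Fin.injective⇒≤ root-injective) (ℕ.<⇒≱ 1+half<q)
    where
    root : Fin q → Fin (suc half)
    root v = proj₁ (every-square v)
    root-injective : Injective _≡_ _≡_ root
    root-injective {v} {w} eq =
      trans (sym (proj₂ (every-square v))) (trans (cong (λ z → residue (square z) q) eq) (proj₂ (every-square w)))
    half≢0 : half ≢ 0
    half≢0 half≡0 = ¬prime[1] (subst Prime (trans q≡1+2half (cong (λ h → suc (h ℕ.+ h)) half≡0)) q-prime)
    1+half<q : suc half ℕ.< q
    1+half<q = subst (suc half ℕ.<_) (sym q≡1+2half)
      (s≤s (subst (ℕ._< half ℕ.+ half) (ℕ.+-identityʳ half) (ℕ.+-monoʳ-< half (ℕ.n≢0⇒n>0 half≢0))))
  ... | no ¬every-square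
    with v , v-nonsquare ← Fin.¬∀⟶∃¬ q _ (λ v → Fin.any? (λ z → residue (square z) q Fin.≟ v)) ¬every-square
    = + toℕ v , q∤v , nonsquare
    where
    q∤v : ¬ + q ∣ + toℕ v
    q∤v q∣v = v-nonsquare (Fin.zero ,
      trans (∣⇒residue-≡ 0ℤ (+ toℕ v) (∣-respʳ (sym (ℤ.+-identityˡ _)) (∣m⇒∣-m q∣v))) (residue-toℕ v))
    nonsquare : ∀ y → ¬ + q ∣ y * y - + toℕ v
    nonsquare y q∣y²-v = let z , q∣y²-z² = square-representative y in
      v-nonsquare (z , trans (∣⇒residue-≡ (square z) (+ toℕ v)
                               (∣-respʳ (cancel (y * y) (square z) (+ toℕ v)) (∣m∣n⇒∣m-n q∣y²-v q∣y²-z²)))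
                             (residue-toℕ v))
      where
      cancel : ∀ a b c → a - c - (a - b) ≡ b - c
      cancel = solve-∀

module QuadraticForms {q : ℕ} (q-prime : Prime q) (7≤q : 7 ℕ.≤ q) where

  q∤small : ∀ {k} → 0 ℕ.< k → k ℕ.≤ 5 → ¬ + q ∣ + k
  q∤small 0<k k≤5 = prime∤small q-prime 0<k (ℕ.<-≤-trans (s≤s (ℕ.m≤n⇒m≤1+n k≤5)) 7≤q)

  UnitIsotropic : ℤ → ℤ → ℤ → Set
  UnitIsotropic a b c = ∃₂ λ r s → ∃ λ u → ¬ + q ∣ r × ¬ + q ∣ s × ¬ + q ∣ u ×
                          + q ∣ a * (r * r) + b * (s * s) + c * (u * u)

  UnitIsotropic-swap : ∀ {a b c} → UnitIsotropic b a c → UnitIsotropic a b c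
  UnitIsotropic-swap {a} {b} {c} (r , s , u , q∤r , q∤s , q∤u , q∣) =
    s , r , u , q∤s , q∤r , q∤u , ∣-respʳ (swap a b c r s u) q∣
    where
    swap : ∀ a b c r s u → b * (r * r) + a * (s * s) + c * (u * u) ≡ a * (s * s) + b * (r * r) + c * (u * u)
    swap = solve-∀

  private
    -- If D ≡ ±1 then k = 2 gives 4D ± 1 ∈ {±3, ±5} (mod q), which is nonzero because q ≥ 7.
    good-scale : ∀ D → ∃ λ k → ¬ + q ∣ k × ¬ + q ∣ D * (k * k) + 1ℤ × ¬ + q ∣ D * (k * k) - 1ℤ
    good-scale D with + q ∣? D - 1ℤ | + q ∣? D + 1ℤ
    ... | yes q∣D-1 | _ = + 2 , q∤small (s≤s z≤n) (s≤s (s≤s z≤n)) ,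
      (λ q∣ → q∤small (s≤s z≤n) ℕ.≤-refl (∣-respʳ (five D) (∣m∣n⇒∣m-n q∣ (∣n⇒∣m*n (+ 4) q∣D-1)))) ,
      (λ q∣ → q∤small (s≤s z≤n) (s≤s (s≤s (s≤s z≤n))) (∣-respʳ (three D) (∣m∣n⇒∣m-n q∣ (∣n⇒∣m*n (+ 4) q∣D-1))))
      where
      five : ∀ D → D * (+ 2 * + 2) + 1ℤ - + 4 * (D - 1ℤ) ≡ + 5
      five = solve-∀
      three : ∀ D → D * (+ 2 * + 2) - 1ℤ - + 4 * (D - 1ℤ) ≡ + 3
      three = solve-∀
    ... | no _ | yes q∣D+1 = + 2 , q∤small (s≤s z≤n) (s≤s (s≤s z≤n)) ,
      (λ q∣ → q∤small (s≤s z≤n) (s≤s (s≤s (s≤s z≤n))) (∣-respʳ (three D) (∣m∣n⇒∣m-n (∣n⇒∣m*n (+ 4) q∣D+1) q∣))) ,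
      (λ q∣ → q∤small (s≤s z≤n) ℕ.≤-refl (∣-respʳ (five D) (∣m∣n⇒∣m-n (∣n⇒∣m*n (+ 4) q∣D+1) q∣)))
      where
      three : ∀ D → + 4 * (D + 1ℤ) - (D * (+ 2 * + 2) + 1ℤ) ≡ + 3
      three = solve-∀
      five : ∀ D → + 4 * (D + 1ℤ) - (D * (+ 2 * + 2) - 1ℤ) ≡ + 5
      five = solve-∀
    ... | no q∤D-1 | no q∤D+1 = 1ℤ , prime∤1 q-prime ,
      (λ q∣ → q∤D+1 (∣-respʳ (cong (_+ 1ℤ) (ℤ.*-identityʳ D)) q∣)) ,
      (λ q∣ → q∤D-1 (∣-respʳ (cong (_- 1ℤ) (ℤ.*-identityʳ D)) q∣))

  binary-isotropic⇒ternary : ∀ {a b c t} → ¬ + q ∣ a → ¬ + q ∣ b → ¬ + q ∣ t →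
                             + q ∣ b * (t * t) + c → UnitIsotropic a b c
  binary-isotropic⇒ternary {a} {b} {c} {t} q∤a q∤b q∤t q∣bt²+c =
    let k , q∤k , q∤X+1 , q∤X-1 = good-scale (- (a * b))
        X = - (a * b) * (k * k)
    in + 2 * k * b * t , (X + 1ℤ) * t , X - 1ℤ ,
       prime∤* q-prime (prime∤* q-prime (prime∤* q-prime (q∤small (s≤s z≤n) (s≤s (s≤s z≤n))) q∤k) q∤b) q∤t ,
       prime∤* q-prime q∤X+1 q∤t , q∤X-1 ,
       ∣-respʳ (sym (identity a b c k t X))
         (∣m∣n⇒∣m+n (∣n⇒∣m*n ((X - 1ℤ) * (X - 1ℤ)) q∣bt²+c)
                    (∣n⇒∣m*n (+ 4 * b * (t * t)) (∣-respʳ (sym (cancel a b k)) (divides 0ℤ refl))))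
    where
    -- With X = -abk² the last summand vanishes, so the value is a multiple of b t² + c.
    identity : ∀ a b c k t X →
      a * ((+ 2 * k * b * t) * (+ 2 * k * b * t)) + b * ((X + 1ℤ) * t * ((X + 1ℤ) * t)) + c * ((X - 1ℤ) * (X - 1ℤ))
      ≡ (X - 1ℤ) * (X - 1ℤ) * (b * (t * t) + c) + + 4 * b * (t * t) * (a * b * (k * k) + X)
    identity = solve-∀
    cancel : ∀ a b k → a * b * (k * k) + - (a * b) * (k * k) ≡ 0ℤ
    cancel = solve-∀

  q≢2 : q ≢ 2
  q≢2 q≡2 with subst (7 ℕ.≤_) q≡2 7≤q
  ... | s≤s (s≤s ())

  binary-represents⇒ternary-isotropic : ∀ {a b c} s t → ¬ + q ∣ a → ¬ + q ∣ b → ¬ + q ∣ c →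
    + q ∣ a * (s * s) + b * (t * t) - - c → UnitIsotropic a b c
  binary-represents⇒ternary-isotropic {a} {b} {c} s t q∤a q∤b q∤c q∣as²+bt²+c with + q ∣? s | + q ∣? t
  ... | yes q∣s | yes q∣t = contradiction (∣-respʳ (drop-both a b c s t)
          (∣m∣n⇒∣m-n (∣m∣n⇒∣m-n q∣as²+bt²+c (∣n⇒∣m*n a (∣m⇒∣m*n s q∣s))) (∣n⇒∣m*n b (∣m⇒∣m*n t q∣t)))) q∤c
    where
    drop-both : ∀ a b c s t → a * (s * s) + b * (t * t) - - c - a * (s * s) - b * (t * t) ≡ c
    drop-both = solve-∀
  ... | yes q∣s | no q∤t = binary-isotropic⇒ternary q∤a q∤b q∤t
          (∣-respʳ (drop-left a b c s t) (∣m∣n⇒∣m-n q∣as²+bt²+c (∣n⇒∣m*n a (∣m⇒∣m*n s q∣s))))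
    where
    drop-left : ∀ a b c s t → a * (s * s) + b * (t * t) - - c - a * (s * s) ≡ b * (t * t) + c
    drop-left = solve-∀
  ... | no q∤s | yes q∣t = UnitIsotropic-swap {a} {b} {c} (binary-isotropic⇒ternary q∤b q∤a q∤s
          (∣-respʳ (drop-right a b c s t) (∣m∣n⇒∣m-n q∣as²+bt²+c (∣n⇒∣m*n b (∣m⇒∣m*n t q∣t)))))
    where
    drop-right : ∀ a b c s t → a * (s * s) + b * (t * t) - - c - b * (t * t) ≡ a * (s * s) + c
    drop-right = solve-∀
  ... | no q∤s | no q∤t = s , t , 1ℤ , q∤s , q∤t , prime∤1 q-prime ,
          ∣-respʳ (unit-third a b c s t) q∣as²+bt²+c
    where
    unit-third : ∀ a b c s t → a * (s * s) + b * (t * t) - - c ≡ a * (s * s) + b * (t * t) + c * (1ℤ * 1ℤ)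
    unit-third = solve-∀

  ternary-isotropic : ∀ {a b c} → ¬ + q ∣ a → ¬ + q ∣ b → ¬ + q ∣ c → UnitIsotropic a b c
  ternary-isotropic {c = c} q∤a q∤b q∤c =
    let s , t , q∣as²+bt²+c = Squares.binary-form-surjective q-prime q≢2 q∤a q∤b (- c)
    in binary-represents⇒ternary-isotropic s t q∤a q∤b q∤c q∣as²+bt²+c

  private
    punchIn-∈ : ∀ {X : Vector ℤ 4} {I k} → I ∩ nonzeroMod q X ≡ ∁ ⁅ k ⁆ → ∀ j → punchIn k j ∈ I ∩ nonzeroMod q X
    punchIn-∈ {k = k} I∩Z≡∁k j = subst (punchIn k j ∈_) (sym I∩Z≡∁k) (x∉p⇒x∈∁p (x≢y⇒x∉⁅y⁆ (Fin.punchInᵢ≢i k j)))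

  extend-by-unit : ∀ (X : Vector ℤ 4) I k → I ∩ nonzeroMod q X ≡ ∁ ⁅ k ⁆ →
    ∀ (t : Vector ℤ 3) → (∀ j → ¬ + q ∣ t j) → + q ∣ sum (λ j → t j * t j * X (punchIn k j)) →
    ∃ λ s → (∀ i → ¬ + q ∣ s i) × + q ∣ sum (restrict I (λ i → s i * s i * X i))
  extend-by-unit X I k I∩Z≡∁k t q∤t q∣Σt = s , q∤s , ∣-respʳ (sym Σ-split) (∣m∣n⇒∣m+n q∣k-term q∣Σt)
    where
    s : Vector ℤ 4
    s = insertAt t k 1ℤ
    q∤s : ∀ i → ¬ + q ∣ s i
    q∤s i with k Fin.≟ i
    ... | yes refl = subst (λ v → ¬ + q ∣ v) (sym (insertAt-lookup t k 1ℤ)) (prime∤1 q-prime)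
    ... | no k≢i = subst (λ i → ¬ + q ∣ s i) (Fin.punchIn-punchOut k≢i)
                     (subst (λ v → ¬ + q ∣ v) (sym (insertAt-punchIn t k 1ℤ (punchOut k≢i))) (q∤t (punchOut k≢i)))
    F : Vector ℤ 4
    F i = s i * s i * X i
    q∣k-term : + q ∣ restrict I F k
    q∣k-term = restrict-∣ I {f = F} (λ k∈I → ∣n⇒∣m*n (s k * s k) (∉-nonzeroMod⇒∣ X (λ k∈Z →
      x∈∁p⇒x∉p (subst (k ∈_) I∩Z≡∁k (x∈p∩q⁺ (k∈I , k∈Z))) (x∈⁅x⁆ k))))
    Σ-split : sum (restrict I F) ≡ restrict I F k + sum (λ j → t j * t j * X (punchIn k j))
    Σ-split = trans (sum-remove (restrict I F)) (cong (λ Σ → restrict I F k + Σ) (sum-cong-≗ λ j →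
      trans (restrict-∈ I F (proj₁ (x∈p∩q⁻ I _ (punchIn-∈ {X = X} I∩Z≡∁k j))))
            (cong (λ v → v * v * X (punchIn k j)) (insertAt-punchIn t k 1ℤ j))))

  squares-annihilate : ∀ (X : Vector ℤ 4) (I : Subset 4) →
    I ∩ nonzeroMod q X ≡ Subset.⊥ ⊎ (∃ λ k → I ∩ nonzeroMod q X ≡ ∁ ⁅ k ⁆) →
    ∃ λ s → (∀ i → ¬ + q ∣ s i) × + q ∣ sum (restrict I (λ i → s i * s i * X i))
  squares-annihilate X I (inj₁ I∩Z≡⊥) =
    (λ _ → 1ℤ) , (λ _ → prime∤1 q-prime) , ∣-sum (λ i → restrict-∣ I {f = λ i → 1ℤ * 1ℤ * X i} (q∣X i))
    where
    q∣X : ∀ i → i ∈ I → + q ∣ 1ℤ * 1ℤ * X i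
    q∣X i i∈I = ∣n⇒∣m*n (1ℤ * 1ℤ) (∉-nonzeroMod⇒∣ X (λ i∈Z → ∉⊥ (subst (i ∈_) I∩Z≡⊥ (x∈p∩q⁺ (i∈I , i∈Z)))))
  squares-annihilate X I (inj₂ (k , I∩Z≡∁k)) =
    let r , s , u , q∤r , q∤s , q∤u , q∣ = ternary-isotropic (q∤z Fin.zero) (q∤z (Fin.suc Fin.zero))
                                                             (q∤z (Fin.suc (Fin.suc Fin.zero)))
    in extend-by-unit X I k I∩Z≡∁k (λ { Fin.zero → r ; (Fin.suc Fin.zero) → s ; (Fin.suc (Fin.suc Fin.zero)) → u })
         (λ { Fin.zero → q∤r ; (Fin.suc Fin.zero) → q∤s ; (Fin.suc (Fin.suc Fin.zero)) → q∤u })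
         (∣-respʳ (rearrange (z Fin.zero) (z (Fin.suc Fin.zero)) (z (Fin.suc (Fin.suc Fin.zero))) r s u) q∣)
    where
    z : Fin 3 → ℤ
    z j = X (punchIn k j)
    q∤z : ∀ j → ¬ + q ∣ z j
    q∤z j = ∈-nonzeroMod⇒∤ X (proj₂ (x∈p∩q⁻ I _ (punchIn-∈ {X = X} I∩Z≡∁k j)))
    rearrange : ∀ a b c r s u → a * (r * r) + b * (s * s) + c * (u * u) ≡ r * r * a + (s * s * b + (u * u * c + 0ℤ))
    rearrange = solve-∀

-- The Legendre symbol

private
  legendre-unit : ∀ a k → a ℕ.% suc k ≢ 0 → legendre a (suc k) ≡ 1ℤ ⊎ legendre a (suc k) ≡ -1ℤ
  legendre-unit a k a≢0 with a ℕ.% suc k ℕ.≟ 0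
  ... | yes a≡0 = contradiction a≡0 a≢0
  ... | no _ with Fin.any? (λ (x : Fin (suc k)) → (toℕ x ℕ.* toℕ x) ℕ.% suc k ℕ.≟ a ℕ.% suc k)
  ...   | yes _ = inj₁ refl
  ...   | no _  = inj₂ refl

  legendre≡1⇒square : ∀ a k → legendre a (suc k) ≡ 1ℤ →
                      ∃ λ (x : Fin (suc k)) → (toℕ x ℕ.* toℕ x) ℕ.% suc k ≡ a ℕ.% suc k
  legendre≡1⇒square a k leg≡1 with a ℕ.% suc k ℕ.≟ 0
  ... | yes _ with () ← leg≡1
  ... | no _ with Fin.any? (λ (x : Fin (suc k)) → (toℕ x ℕ.* toℕ x) ℕ.% suc k ℕ.≟ a ℕ.% suc k)
  ...   | yes square = square
  ...   | no _ with () ← leg≡1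

  square⇒legendre≡1 : ∀ a k → a ℕ.% suc k ≢ 0 →
                      (∃ λ (x : Fin (suc k)) → (toℕ x ℕ.* toℕ x) ℕ.% suc k ≡ a ℕ.% suc k) → legendre a (suc k) ≡ 1ℤ
  square⇒legendre≡1 a k a≢0 square with a ℕ.% suc k ℕ.≟ 0
  ... | yes a≡0 = contradiction a≡0 a≢0
  ... | no _ with Fin.any? (λ (x : Fin (suc k)) → (toℕ x ℕ.* toℕ x) ℕ.% suc k ℕ.≟ a ℕ.% suc k)
  ...   | yes _ = refl
  ...   | no ¬square = contradiction square ¬square

legendre-±1 : ∀ a q .{{_ : NonZero q}} → ¬ + q ∣ + a → legendre a q ≡ 1ℤ ⊎ legendre a q ≡ -1ℤ
legendre-±1 a (suc k) q∤a = legendre-unit a k (d∤m⇒m%d≢0 q∤a)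

legendre≡1⇒∣-square : ∀ a q .{{_ : NonZero q}} → legendre a q ≡ 1ℤ → ∃ λ s → + q ∣ + a - s * s
legendre≡1⇒∣-square a (suc k) leg≡1 =
  let x , x²≡a = legendre≡1⇒square a k leg≡1
  in + toℕ x , ∣-respʳ (cong (λ s → + a - s) (ℤ.pos-* (toℕ x) (toℕ x)))
                       (m%d≡n%d⇒d∣m-n a (toℕ x ℕ.* toℕ x) (sym x²≡a))

∣-square⇒legendre≡1 : ∀ a q .{{_ : NonZero q}} s → ¬ + q ∣ + a → + q ∣ + a - s * s → legendre a q ≡ 1ℤ
∣-square⇒legendre≡1 a q@(suc k) s q∤a q∣a-s² =
  square⇒legendre≡1 a k (d∤m⇒m%d≢0 q∤a) (x , d∣m-n⇒m%d≡n%d (toℕ x ℕ.* toℕ x) a q∣x²-a)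
  where
  x = residue s q
  expand : ∀ s t a → - ((s - t) * (s + t)) - (a - s * s) ≡ t * t - a
  expand = solve-∀
  q∣x²-a : + q ∣ + (toℕ x ℕ.* toℕ x) - + a
  q∣x²-a = ∣-respʳ (trans (expand s (+ toℕ x) (+ a)) (cong (λ t² → t² - + a) (sym (ℤ.pos-* (toℕ x) (toℕ x)))))
    (∣m∣n⇒∣m-n (∣m⇒∣-m (∣m⇒∣m*n (s + + toℕ x) (∣-residue s))) q∣a-s²)

-- The Davenport constant of L(pq; p)

∀-subset? : ∀ {n} {P : Subset n → Set} → Decidable P → Dec (∀ S → P S)
∀-subset? P? with anySubset? (λ S → ¬? (P? S))
... | yes (S , ¬PS) = no (λ ∀P → ¬PS (∀P S))
... | no ∄¬P = yes (λ S → decidable-stable (P? S) (λ ¬PS → ∄¬P (S , ¬PS)))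

-- With Y, Z the terms that are nonzero mod p and mod q, these are the subsequences I that
-- units-annihilate and squares-annihilate can handle.
Admissible : (Y Z : Subset 4) → Subset 4 → Set
Admissible Y Z I = Nonempty I × Subset.∣ I ∩ Y ∣ ≢ 1 × (I ∩ Z ≡ Subset.⊥ ⊎ ∃ λ k → I ∩ Z ≡ ∁ ⁅ k ⁆)

admissible? : ∀ Y Z → Decidable (Admissible Y Z)
admissible? Y Z I = nonempty? I ×-dec ¬? (Subset.∣ I ∩ Y ∣ ℕ.≟ 1) ×-dec
  (≡-dec _≟ᵇ_ (I ∩ Z) Subset.⊥ ⊎-dec Fin.any? (λ k → ≡-dec _≟ᵇ_ (I ∩ Z) (∁ ⁅ k ⁆)))

-- Decided by evaluation over all pairs (Y , Z); opaque, as unfolding it at a use site is very costly.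
opaque
  admissible-exists : ∀ Y Z → ∃ (Admissible Y Z)
  admissible-exists = from-yes (∀-subset? λ Y → ∀-subset? λ Z → anySubset? (admissible? Y Z))

DavenportProp-suc : ∀ {n A l} → DavenportProp n A l → DavenportProp n A (suc l)
DavenportProp-suc zero-sum x =
  let I , (i , i∈I) , w , w∈A , n∣Σ = zero-sum (x ∘ Fin.suc)
  in outside ∷ I , (Fin.suc i , there i∈I) , (λ { Fin.zero → x Fin.zero ; (Fin.suc i) → w i }) ,
     (λ { Fin.zero () ; (Fin.suc i) (there i∈I) → w∈A i i∈I }) , n∣Σ

DavenportProp-mono : ∀ {n A k l} → k ℕ.≤ l → DavenportProp n A k → DavenportProp n A l
DavenportProp-mono {n} {A} k≤l = mono (ℕ.≤⇒≤′ k≤l)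
  where
  mono : ∀ {k l} → k ℕ.≤′ l → DavenportProp n A k → DavenportProp n A l
  mono ℕ.≤′-refl        zero-sum = zero-sum
  mono (ℕ.≤′-step k≤′l) zero-sum = DavenportProp-suc {A = A} (mono k≤′l zero-sum)

module _ {p q : ℕ} (p-prime : Prime p) (q-prime : Prime q) (p≢q : p ≢ q) (7≤p : 7 ℕ.≤ p) (7≤q : 7 ℕ.≤ q) where

  private
    n = p ℕ.* q

    instance
      p≢0 : NonZero p
      p≢0 = prime⇒nonZero p-prime
      q≢0 : NonZero q
      q≢0 = prime⇒nonZero q-prime
      n≢0 : NonZero n
      n≢0 = ℕ.m*n≢0 p q

    p∣n : + p ∣ + n
    p∣n = ∣ᵤ⇒∣ (ℕ.m∣m*n q)

    q∣n : + q ∣ + n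
    q∣n = ∣ᵤ⇒∣ (ℕ.n∣m*n p)

    p∤q : ¬ + p ∣ + q
    p∤q p∣q with prime⇒irreducible q-prime (∣⇒∣ᵤ p∣q)
    ... | inj₁ p≡1 = ¬prime[1] (subst Prime p≡1 p-prime)
    ... | inj₂ p≡q = p≢q p≡q

    p⊥q : Coprime p q
    p⊥q = Coprime.sym (prime∤⇒coprime p-prime p∤q)

  QuadraticWeight : ℤ → Set
  QuadraticWeight W = ¬ + p ∣ W × ∃ λ s → ¬ + q ∣ s × + q ∣ W - s * s

  quadraticWeight⇒q∤ : ∀ {W} → QuadraticWeight W → ¬ + q ∣ W
  quadraticWeight⇒q∤ {W} (_ , s , q∤s , q∣W-s²) q∣W =
    prime∤* q-prime q∤s q∤s (∣-respʳ (cancel W (s * s)) (∣m∣n⇒∣m-n q∣W q∣W-s²))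
    where
    cancel : ∀ a b → a - (a - b) ≡ b
    cancel = solve-∀

  quadraticWeight⇒L2 : ∀ w → QuadraticWeight (+ toℕ w) → L2 p q w
  quadraticWeight⇒L2 w weight@(p∤w , s , _ , q∣w-s²) =
    coprime-*ʳ (prime∤⇒coprime p-prime p∤w) (prime∤⇒coprime q-prime q∤w) ,
    trans (cong (λ l → legendre (toℕ w) p * (l * 1ℤ)) (∣-square⇒legendre≡1 (toℕ w) q s q∤w q∣w-s²))
          (trans (cong (legendre (toℕ w) p *_) (ℤ.*-identityˡ 1ℤ)) (ℤ.*-identityʳ _))
    where
    q∤w = quadraticWeight⇒q∤ weight

  L2⇒quadraticWeight : ∀ w → L2 p q w → QuadraticWeight (+ toℕ w)
  L2⇒quadraticWeight w (w⊥n , jacobi≡legendre) = p∤w , s , q∤s , q∣w-s²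
    where
    prime-factor∤w : ∀ {r} → Prime r → r ℕ.∣ n → ¬ + r ∣ + toℕ w
    prime-factor∤w r-prime r∣n r∣w = ¬prime[1] (subst Prime (w⊥n (∣⇒∣ᵤ r∣w , r∣n)) r-prime)
    p∤w = prime-factor∤w p-prime (ℕ.m∣m*n q)
    q∤w = prime-factor∤w q-prime (ℕ.n∣m*n p)
    legendre-q≡1 : legendre (toℕ w) q ≡ 1ℤ
    legendre-q≡1 = cancel (legendre-±1 (toℕ w) p p∤w) jacobi≡legendre
      where
      cancel : ∀ {l m} → l ≡ 1ℤ ⊎ l ≡ -1ℤ → l * (m * 1ℤ) ≡ l → m ≡ 1ℤ
      cancel {m = m} (inj₁ refl) eq = trans (sym (ℤ.*-identityʳ m)) (ℤ.*-cancelˡ-≡ 1ℤ (m * 1ℤ) 1ℤ eq)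
      cancel {m = m} (inj₂ refl) eq = trans (sym (ℤ.*-identityʳ m)) (ℤ.*-cancelˡ-≡ -1ℤ (m * 1ℤ) 1ℤ eq)
    s = proj₁ (legendre≡1⇒∣-square (toℕ w) q legendre-q≡1)
    q∣w-s² = proj₂ (legendre≡1⇒∣-square (toℕ w) q legendre-q≡1)
    q∤s : ¬ + q ∣ s
    q∤s q∣s = q∤w (∣-respʳ (cancel (+ toℕ w) (s * s)) (∣m∣n⇒∣m+n q∣w-s² (∣m⇒∣m*n s q∣s)))
      where
      cancel : ∀ a b → a - b + b ≡ a
      cancel = solve-∀

  private
    toℤ : ∀ {l} → (Fin l → Fin n) → Vector ℤ l
    toℤ x i = + toℕ (x i)

  zero-sums⇒weighted-zero-sum : ∀ {l} (x : Fin l → Fin n) (I : Subset l) → Nonempty I →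
    (u s : Vector ℤ l) → (∀ i → ¬ + p ∣ u i) → (∀ i → ¬ + q ∣ s i) →
    + p ∣ sum (restrict I (λ i → u i * toℤ x i)) → + q ∣ sum (restrict I (λ i → s i * s i * toℤ x i)) →
    HasWeightedZeroSumSubseq n (L2 p q) l x
  zero-sums⇒weighted-zero-sum x I nonempty u s p∤u q∤s p∣Σ q∣Σ = I , nonempty , w , (λ i _ → w∈L2 i) , n∣Σ
    where
    W : ∀ i → ∃ λ W → + p ∣ W - u i × + q ∣ W - s i * s i
    W i = chinese-remainder p⊥q (u i) (s i * s i)
    w : Fin _ → Fin n
    w i = residue (proj₁ (W i)) n
    reduce : ∀ {d a} i → + d ∣ + n → + d ∣ proj₁ (W i) - a → + d ∣ + toℕ (w i) - a
    reduce {a = a} i d∣n d∣W-a = ∣-respʳ (cancel (proj₁ (W i)) (+ toℕ (w i)) a)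
      (∣m∣n⇒∣m-n d∣W-a (∣-trans d∣n (∣-residue (proj₁ (W i)))))
      where
      cancel : ∀ W w a → W - a - (W - w) ≡ w - a
      cancel = solve-∀
    w≡u : ∀ i → + p ∣ + toℕ (w i) - u i
    w≡u i = reduce i p∣n (proj₁ (proj₂ (W i)))
    w≡s² : ∀ i → + q ∣ + toℕ (w i) - s i * s i
    w≡s² i = reduce i q∣n (proj₂ (proj₂ (W i)))
    w∈L2 : ∀ i → L2 p q (w i)
    w∈L2 i = quadraticWeight⇒L2 (w i) (p∤w , s i , q∤s i , w≡s² i)
      where
      p∤w : ¬ + p ∣ + toℕ (w i)
      p∤w p∣w = p∤u i (∣-respʳ (cancel (+ toℕ (w i)) (u i)) (∣m∣n⇒∣m-n p∣w (w≡u i)))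
        where
        cancel : ∀ w u → w - (w - u) ≡ u
        cancel = solve-∀
    wx : Vector ℤ _
    wx i = + (toℕ (w i) ℕ.* toℕ (x i))
    replace : ∀ {d} (v : Vector ℤ _) → (∀ i → + d ∣ + toℕ (w i) - v i) →
              ∀ i → i ∈ I → + d ∣ v i * toℤ x i - wx i
    replace v w≡v i _ = ∣-respʳ (trans (factor (v i) (+ toℕ (w i)) (toℤ x i)) (cong (λ t → v i * toℤ x i - t)
                          (sym (ℤ.pos-* (toℕ (w i)) (toℕ (x i))))))
                          (∣m⇒∣-m (∣m⇒∣m*n (toℤ x i) (w≡v i)))
      where
      factor : ∀ v w x → - ((w - v) * x) ≡ v * x - w * x
      factor = solve-∀
    n∣Σ : n ℕ.∣ Σ[< _ ] (λ i → if lookup I i then toℕ (w i) ℕ.* toℕ (x i) else 0)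
    n∣Σ = ∣⇒∣ᵤ (subst (+ n ∣_) (sym (sum-restrict-pos I (λ i → toℕ (w i) ℕ.* toℕ (x i))))
            (coprime⇒*∣ p⊥q (restricted-sum-cong I _ wx (replace u w≡u) p∣Σ)
                             (restricted-sum-cong I _ wx (replace (λ i → s i * s i) w≡s²) q∣Σ)))

  four-suffices : DavenportProp n (L2 p q) 4
  four-suffices x =
    let I , nonempty , ∣K∣≢1 , shape = admissible-exists (nonzeroMod p (toℤ x)) (nonzeroMod q (toℤ x))
        u , p∤u , p∣Σ = units-annihilate p-prime (toℤ x) I ∣K∣≢1
                          (ℕ.≤-trans (∣p∣≤n (I ∩ nonzeroMod p (toℤ x))) (ℕ.≤-trans 4≤7 7≤p))
        s , q∤s , q∣Σ = QuadraticForms.squares-annihilate q-prime 7≤q (toℤ x) I shape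
    in zero-sums⇒weighted-zero-sum x I nonempty u s p∤u q∤s p∣Σ q∣Σ
    where
    4≤7 : 4 ℕ.≤ 7
    4≤7 = ℕ.m≤m+n 4 3

  module _ (r : ℤ) (q∤r : ¬ + q ∣ r) (r-nonsquare : ∀ y → ¬ + q ∣ y * y - r) where

    private
      c : Vector ℤ 3
      c Fin.zero                   = 1ℤ
      c (Fin.suc Fin.zero)         = - r
      c (Fin.suc (Fin.suc Fin.zero)) = + q

      x : Fin 3 → Fin n
      x i = residue (c i) n

      first-two-terms : ∀ b₀ b₁ b₂ (W : Vector ℤ 3) → + q ∣ sum (restrict (b₀ ∷ b₁ ∷ b₂ ∷ []) (λ i → W i * c i)) →
        + q ∣ select b₀ (W Fin.zero * 1ℤ) + select b₁ (W (Fin.suc Fin.zero) * - r)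
      first-two-terms b₀ b₁ b₂ W q∣Σ =
        ∣-respʳ (cancel (select b₀ (W Fin.zero * 1ℤ)) (select b₁ (W (Fin.suc Fin.zero) * - r)) (select b₂ (W₂ * + q)))
                (∣m∣n⇒∣m-n q∣Σ (q∣third b₂))
        where
        W₂ = W (Fin.suc (Fin.suc Fin.zero))
        q∣third : ∀ b → + q ∣ select b (W₂ * + q)
        q∣third true  = ∣n⇒∣m*n W₂ ∣-refl
        q∣third false = divides 0ℤ refl
        cancel : ∀ a b c → a + (b + (c + 0ℤ)) - c ≡ a + b
        cancel = solve-∀

      refute : ∀ b₀ b₁ b₂ (W : Vector ℤ 3) → Nonempty (b₀ ∷ b₁ ∷ b₂ ∷ []) →
               (∀ i → i ∈ (b₀ ∷ b₁ ∷ b₂ ∷ []) → QuadraticWeight (W i)) →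
               + p ∣ sum (restrict (b₀ ∷ b₁ ∷ b₂ ∷ []) (λ i → W i * c i)) →
               + q ∣ sum (restrict (b₀ ∷ b₁ ∷ b₂ ∷ []) (λ i → W i * c i)) → ⊥
      refute false false false W (i , i∈⊥) _ _ _ = ∉⊥ i∈⊥
      refute false false true W _ weight p∣Σ _ =
        prime∤* p-prime (proj₁ (weight _ (there (there here)))) p∤q
          (∣-respʳ (cancel (W (Fin.suc (Fin.suc Fin.zero)) * + q)) p∣Σ)
        where
        cancel : ∀ a → 0ℤ + (0ℤ + (a + 0ℤ)) ≡ a
        cancel = solve-∀
      refute true false b₂ W _ weight _ q∣Σ =
        quadraticWeight⇒q∤ (weight _ here) (∣-respʳ (cancel (W Fin.zero)) (first-two-terms true false b₂ W q∣Σ))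
        where
        cancel : ∀ a → a * 1ℤ + 0ℤ ≡ a
        cancel = solve-∀
      refute false true b₂ W _ weight _ q∣Σ =
        prime∤* q-prime (quadraticWeight⇒q∤ (weight _ (there here))) q∤-r
          (∣-respʳ (ℤ.+-identityˡ (W (Fin.suc Fin.zero) * - r)) (first-two-terms false true b₂ W q∣Σ))
        where
        q∤-r : ¬ + q ∣ - r
        q∤-r q∣-r = q∤r (∣-respʳ (ℤ.neg-involutive r) (∣m⇒∣-m q∣-r))
      refute true true b₂ W _ weight _ q∣Σ =
        let _ , s₀ , _ , q∣W₀-s₀² = weight _ here
            _ , s₁ , q∤s₁ , q∣W₁-s₁² = weight _ (there here)
            y , q∣y²-r = ratio-of-squares-is-square q-prime {W Fin.zero} {W (Fin.suc Fin.zero)} {r} {s₀} {s₁}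
                           q∤s₁ q∣W₀-s₀² q∣W₁-s₁²
                           (∣-respʳ (cancel (W Fin.zero) (W (Fin.suc Fin.zero)) r)
                                    (first-two-terms true true b₂ W q∣Σ))
        in r-nonsquare y q∣y²-r
        where
        cancel : ∀ a b r → a * 1ℤ + b * - r ≡ a - b * r
        cancel = solve-∀

    three-insufficient : ¬ DavenportProp n (L2 p q) 3
    three-insufficient three-suffices with three-suffices x
    ... | I@(b₀ ∷ b₁ ∷ b₂ ∷ []) , nonempty , w , w∈L2 , n∣Σ =
      refute b₀ b₁ b₂ W nonempty (λ i i∈I → L2⇒quadraticWeight (w i) (w∈L2 i i∈I))
        (∣-trans p∣n n∣ΣWc) (∣-trans q∣n n∣ΣWc)
      where
      W : Vector ℤ 3
      W i = + toℕ (w i)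
      expand : ∀ w x c → w * - (c - x) ≡ w * x - w * c
      expand = solve-∀
      congruent : ∀ i → i ∈ I → + n ∣ + (toℕ (w i) ℕ.* toℕ (x i)) - W i * c i
      congruent i _ = ∣-respʳ (trans (expand (W i) (+ toℕ (x i)) (c i))
                                     (cong (λ t → t - W i * c i) (sym (ℤ.pos-* (toℕ (w i)) (toℕ (x i))))))
                              (∣n⇒∣m*n (W i) (∣m⇒∣-m (∣-residue (c i))))
      n∣ΣWc : + n ∣ sum (restrict I (λ i → W i * c i))
      n∣ΣWc = restricted-sum-cong I (λ i → + (toℕ (w i) ℕ.* toℕ (x i))) (λ i → W i * c i) congruent
                (subst (+ n ∣_) (sum-restrict-pos I (λ i → toℕ (w i) ℕ.* toℕ (x i))) (∣ᵤ⇒∣ n∣Σ))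

    four-necessary : ∀ k → DavenportProp n (L2 p q) k → 4 ℕ.≤ k
    four-necessary k k-suffices with 4 ℕ.≤? k
    ... | yes 4≤k = 4≤k
    ... | no 4≰k =
      contradiction (DavenportProp-mono {A = L2 p q} (ℕ.≤-pred (ℕ.≰⇒> 4≰k)) k-suffices) three-insufficient

theorem3p8 : (p' q : ℕ) → Prime p' → Prime q → p' ≢ q → 7 ℕ.≤ p' → 7 ℕ.≤ q →
    DavenportIs (p' ℕ.* q) (L2 p' q) 4
theorem3p8 p' q p'-prime q-prime p'≢q 7≤p' 7≤q =
  let r , q∤r , r-nonsquare = Squares.quadratic-nonresidue q-prime (QuadraticForms.q≢2 q-prime 7≤q)
  in four-suffices p'-prime q-prime p'≢q 7≤p' 7≤q ,
     four-necessary p'-prime q-prime p'≢q 7≤p' 7≤q r q∤r r-nonsquare
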